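{- Let $\pi=a_1\cdots a_k$, where $a_1,\dots,a_k$ are the ascending runs of $\pi$ (in order). Then $\operatorname{SC}_{321}(\pi)=a_1^m\cdots a_k^m\operatorname{rev}(a_1^e\cdots a_k^e)=a_1^m\cdots a_k^m\operatorname{rev}(a_k^e)\cdots\operatorname{rev}(a_1^e)$.
   Context: Permutations of $[n]$ are written in one-line notation. An ascending run of a permutation is a maximal consecutive increasing subsequence. For an ascending run $a_i$, $a_i^m$ is the subsequence of $a_i$ consisting of its entries other than its first and last entries (empty if $|a_i|\le 2$), and $a_i^e$ is the sequence obtained from $a_i$ by deleting $a_i^m$. $\operatorname{rev}$ reverses a sequence; juxtaposition is concatenation. Two sequences of distinct integers have the same relative order if replacing the $i$th smallest entry of each by $i$ yields the same word; a permutation avoids $321$ consecutively if no three consecutive entries are decreasing. $\operatorname{SC}_{321}$ is the map sending a permutation $\pi\in S_n$ through a stack: at each step, if there is a next input entry and placing it on top of the stack would make the stack contents, read top to bottom, avoid $321$ consecutively, push it; otherwise pop the top entry to the end of the output; stop when the output has length $n$. -}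

module Defs where

open import Data.Nat using (ℕ; zero; suc; _+_; _*_; _<_; _<ᵇ_)
open import Data.Bool using (Bool; true; false; if_then_else_; _∧_; not)
open import Data.List using (List; []; _∷_; _++_; reverse; concat; map; length; upTo)
open import Data.List.Relation.Binary.Permutation.Propositional using (_↭_)
open import Data.Product using (_×_; _,_)

IsPerm : ℕ → List ℕ → Set
IsPerm n π = π ↭ map suc (upTo n)

runs : List ℕ → List (List ℕ)
runs [] = []
runs (x ∷ xs) with runs xs
... | [] = (x ∷ []) ∷ []
... | [] ∷ rs = (x ∷ []) ∷ [] ∷ rs   -- never happens (runs are nonempty)
... | (y ∷ r) ∷ rs = if x <ᵇ y then (x ∷ y ∷ r) ∷ rs else (x ∷ []) ∷ (y ∷ r) ∷ rs

-- a^m : the entries of a run other than its first and last (empty if |a| ≤ 2)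
dropLast : List ℕ → List ℕ
dropLast [] = []
dropLast (x ∷ []) = []
dropLast (x ∷ y ∷ ys) = x ∷ dropLast (y ∷ ys)

middle : List ℕ → List ℕ
middle [] = []
middle (x ∷ xs) = dropLast xs

-- a^e : a with a^m deleted, i.e. its first and last entries (just one if |a| = 1)
lastL : List ℕ → List ℕ
lastL [] = []
lastL (x ∷ []) = x ∷ []
lastL (x ∷ y ∷ ys) = lastL (y ∷ ys)

ends : List ℕ → List ℕ
ends [] = []
ends (x ∷ xs) = x ∷ lastL xs

avoids321ᵇ : List ℕ → Bool
avoids321ᵇ (x ∷ y ∷ z ∷ ws) = not ((y <ᵇ x) ∧ (z <ᵇ y)) ∧ avoids321ᵇ (y ∷ z ∷ ws)
avoids321ᵇ _ = true

-- State of the stack machine: (remaining input, stack with top as head, output)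
State : Set
State = List ℕ × List ℕ × List ℕ

step : State → State
step ([] , [] , out) = ([] , [] , out)
step ([] , s ∷ st , out) = ([] , st , out ++ s ∷ [])
step (x ∷ inp , st , out) with avoids321ᵇ (x ∷ st)
step (x ∷ inp , st , out)      | true = (inp , x ∷ st , out)
step (x ∷ inp , [] , out)      | false = (x ∷ inp , [] , out) -- impossible: a one-entry stack avoids 321
step (x ∷ inp , s ∷ st , out)  | false = (x ∷ inp , st , out ++ s ∷ [])

iterate : ℕ → State → State
iterate zero σ = σ
iterate (suc k) σ = iterate k (step σ)

output : State → List ℕ
output (_ , _ , out) = out

-- SC_321(π): every entry is pushed once and popped once, so 2·|π| steps
-- suffice to reach the stopping state.
SC321 : List ℕ → List ℕ
SC321 π = output (iterate (2 * length π) (π , [] , []))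

-- Within an ascending run a₁ < a₂ < ⋯ < aⱼ the machine pushes a₁,
-- then alternately pushes aᵢ and pops it as soon as aᵢ₊₁ arrives (aᵢ₊₁, aᵢ, a₁
-- would be a consecutive 321 on the stack), so exactly aⱼ and a₁ stay behind.
-- The next run starts no higher than aⱼ, so its first entry is pushed at once;
-- hence after the whole input the output is a₁ᵐ⋯aₖᵐ and the stack, read from
-- the top, is rev(a₁ᵉ⋯aₖᵉ), which is then popped.  The stack never holds two
-- consecutive descents, so it avoids 321 consecutively throughout.
module Submission where

open import Defs
open import Data.Nat using (ℕ; zero; suc; _+_; _*_; _<_; _≤_; _<ᵇ_)
open import Data.Nat.Properties
  using (<ᵇ-reflects-<; <-trans; ≤⇒≯; ≮⇒≥; +-suc; +-assoc; +-identityʳ; *-distribˡ-+; +-commutativeSemigroup)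
open import Algebra.Properties.CommutativeSemigroup +-commutativeSemigroup using (interchange)
open import Data.List using (List; []; _∷_; [_]; _++_; reverse; concat; concatMap; map; length)
open import Data.Nat.ListAction using (sum)
open import Data.List.Properties
  using (++-assoc; ++-identityʳ; reverse-++; unfold-reverse; length-++; length-reverse; concatMap-++)
open import Data.List.Relation.Unary.Linked using (Linked; []; [-]; _∷_)
open import Data.Bool using (true; false)
open import Data.Bool.Properties using (∧-zeroʳ)
open import Function using (_∘_)
open import Data.Product using (_×_; _,_)
open import Data.Unit using (⊤; tt)
open import Data.Empty using (⊥-elim)
open import Relation.Nullary.Reflects using (ofʸ; ofⁿ)
open import Relation.Binary.PropositionalEquality using (_≡_; refl; sym; trans; cong; cong₂; module ≡-Reasoning)

<⇒<ᵇ≡true : ∀ {m n} → m < n → (m <ᵇ n) ≡ true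
<⇒<ᵇ≡true {m} {n} m<n with m <ᵇ n | <ᵇ-reflects-< m n
... | true  | _       = refl
... | false | ofⁿ m≮n = ⊥-elim (m≮n m<n)

≤⇒>ᵇ≡false : ∀ {m n} → n ≤ m → (m <ᵇ n) ≡ false
≤⇒>ᵇ≡false {m} {n} n≤m with m <ᵇ n | <ᵇ-reflects-< m n
... | false | _       = refl
... | true  | ofʸ m<n = ⊥-elim (≤⇒≯ n≤m m<n)

lastOr : ℕ → List ℕ → ℕ
lastOr x []       = x
lastOr x (y ∷ ys) = lastOr y ys

lastL-lastOr : ∀ y ys → lastL (y ∷ ys) ≡ [ lastOr y ys ]
lastL-lastOr y []       = refl
lastL-lastOr y (z ∷ zs) = lastL-lastOr z zs

dropLast-++-lastL : ∀ xs → dropLast xs ++ lastL xs ≡ xs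
dropLast-++-lastL []           = refl
dropLast-++-lastL (x ∷ [])     = refl
dropLast-++-lastL (x ∷ y ∷ ys) = cong (x ∷_) (dropLast-++-lastL (y ∷ ys))

length-middle-ends : ∀ r → length (middle r) + length (ends r) ≡ length r
length-middle-ends []       = refl
length-middle-ends (x ∷ xs) = begin
  length (dropLast xs) + suc (length (lastL xs))  ≡⟨ +-suc (length (dropLast xs)) _ ⟩
  suc (length (dropLast xs) + length (lastL xs))  ≡⟨ cong suc (length-++ (dropLast xs)) ⟨
  suc (length (dropLast xs ++ lastL xs))          ≡⟨ cong (suc ∘ length) (dropLast-++-lastL xs) ⟩
  suc (length xs)                                 ∎
  where open ≡-Reasoning

reverse-concat : ∀ {a} {A : Set a} (xss : List (List A)) →
                 reverse (concat xss) ≡ concatMap reverse (reverse xss)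
reverse-concat []         = refl
reverse-concat (xs ∷ xss) = begin
  reverse (xs ++ concat xss)
    ≡⟨ reverse-++ xs (concat xss) ⟩
  reverse (concat xss) ++ reverse xs
    ≡⟨ cong (_++ reverse xs) (reverse-concat xss) ⟩
  concatMap reverse (reverse xss) ++ reverse xs
    ≡⟨ cong (concatMap reverse (reverse xss) ++_) (++-identityʳ (reverse xs)) ⟨
  concatMap reverse (reverse xss) ++ concatMap reverse [ xs ]
    ≡⟨ concatMap-++ reverse (reverse xss) [ xs ] ⟨
  concatMap reverse (reverse xss ++ [ xs ])
    ≡⟨ cong (concatMap reverse) (unfold-reverse xs xss) ⟨
  concatMap reverse (reverse (xs ∷ xss))
    ∎
  where open ≡-Reasoning

_≤Top_ : ℕ → List ℕ → Set
x ≤Top []      = ⊤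
x ≤Top (t ∷ _) = x ≤ t

NextFits : List ℕ → List ℕ → Set
NextFits []      st = ⊤
NextFits (x ∷ _) st = x ≤Top st

NextFits-[] : ∀ inp → NextFits inp []
NextFits-[] []      = tt
NextFits-[] (_ ∷ _) = tt

Avoids : List ℕ → Set
Avoids st = avoids321ᵇ st ≡ true

avoids-push : ∀ {x} st → x ≤Top st → Avoids st → Avoids (x ∷ st)
avoids-push []           _   _  = refl
avoids-push (t ∷ [])     _   _  = refl
avoids-push (t ∷ u ∷ st) x≤t av rewrite ≤⇒>ᵇ≡false x≤t = av

avoids-push₂ : ∀ {x} y st → x ≤Top st → Avoids (x ∷ st) → Avoids (y ∷ x ∷ st)
avoids-push₂     y []       _   _  = refl
avoids-push₂ {x} y (t ∷ st) x≤t av rewrite ≤⇒>ᵇ≡false x≤t | ∧-zeroʳ (x <ᵇ y) = av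

avoids-321-false : ∀ {x y z} st → x < y → y < z → avoids321ᵇ (z ∷ y ∷ x ∷ st) ≡ false
avoids-321-false st x<y y<z rewrite <⇒<ᵇ≡true x<y | <⇒<ᵇ≡true y<z = refl

step-push : ∀ {x inp st out} → Avoids (x ∷ st) → step (x ∷ inp , st , out) ≡ (inp , x ∷ st , out)
step-push {x} {st = st} av with avoids321ᵇ (x ∷ st)
step-push refl | true = refl

step-pop : ∀ {x s inp st out} → avoids321ᵇ (x ∷ s ∷ st) ≡ false →
           step (x ∷ inp , s ∷ st , out) ≡ (x ∷ inp , st , out ++ [ s ])
step-pop {x} {s} {st = st} fails with avoids321ᵇ (x ∷ s ∷ st)
step-pop refl | false = refl

iterate-+ : ∀ m n σ → iterate (m + n) σ ≡ iterate n (iterate m σ)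
iterate-+ zero    n σ = refl
iterate-+ (suc m) n σ = iterate-+ m n (step σ)

drain : ∀ st out → iterate (length st) ([] , st , out) ≡ ([] , [] , out ++ st)
drain []       out = cong (λ o → ([] , [] , o)) (sym (++-identityʳ out))
drain (s ∷ st) out = trans (drain st (out ++ [ s ])) (cong (λ o → ([] , [] , o)) (++-assoc out [ s ] st))

climb : ∀ {f xs} rest st out → Linked _<_ (f ∷ xs) → f ≤Top st → Avoids (f ∷ st) →
        iterate (length xs + length (dropLast xs)) (xs ++ rest , f ∷ st , out)
          ≡ (rest , lastL xs ++ f ∷ st , out ++ dropLast xs)
climb {f} {[]} rest st out _ _ _ = cong (λ o → (rest , f ∷ st , o)) (sym (++-identityʳ out))
climb {f} {y ∷ []} rest st out _ f≤st av
  rewrite step-push {y} {rest} {f ∷ st} {out} (avoids-push₂ y st f≤st av)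
  = cong (λ o → (rest , y ∷ f ∷ st , o)) (sym (++-identityʳ out))
climb {f} {y ∷ z ∷ zs} rest st out (f<y ∷ y<z ∷ z↑) f≤st av = begin
  iterate (length zs + suc d) (step (step (y ∷ z ∷ zs ++ rest , f ∷ st , out)))
    ≡⟨ cong (iterate (length zs + suc d) ∘ step) (step-push (avoids-push₂ y st f≤st av)) ⟩
  iterate (length zs + suc d) (step (z ∷ zs ++ rest , y ∷ f ∷ st , out))
    ≡⟨ cong (iterate (length zs + suc d)) (step-pop (avoids-321-false st f<y y<z)) ⟩
  iterate (length zs + suc d) (z ∷ zs ++ rest , f ∷ st , out ++ [ y ])
    ≡⟨ cong (λ k → iterate k (z ∷ zs ++ rest , f ∷ st , out ++ [ y ])) (+-suc (length zs) d) ⟩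
  iterate (suc (length zs) + d) (z ∷ zs ++ rest , f ∷ st , out ++ [ y ])
    ≡⟨ climb rest st (out ++ [ y ]) (<-trans f<y y<z ∷ z↑) f≤st av ⟩
  (rest , lastL (z ∷ zs) ++ f ∷ st , (out ++ [ y ]) ++ dropLast (z ∷ zs))
    ≡⟨ cong (λ o → (rest , lastL (z ∷ zs) ++ f ∷ st , o)) (++-assoc out [ y ] (dropLast (z ∷ zs))) ⟩
  (rest , lastL (z ∷ zs) ++ f ∷ st , out ++ y ∷ dropLast (z ∷ zs))
    ∎
  where
  open ≡-Reasoning
  d : ℕ
  d = length (dropLast (z ∷ zs))

-- Every entry of a run is pushed, and every middle entry popped, while the run is read.
runSteps : List ℕ → ℕ
runSteps r = length r + length (middle r)

feed-run : ∀ {f xs} rest st out → Linked _<_ (f ∷ xs) → f ≤Top st → Avoids st →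
           iterate (runSteps (f ∷ xs)) (f ∷ xs ++ rest , st , out)
             ≡ (rest , reverse (ends (f ∷ xs)) ++ st , out ++ middle (f ∷ xs))
feed-run {f} {xs} rest st out x↑ f≤st av = begin
  iterate k (step (f ∷ xs ++ rest , st , out))
    ≡⟨ cong (iterate k) (step-push (avoids-push st f≤st av)) ⟩
  iterate k (xs ++ rest , f ∷ st , out)
    ≡⟨ climb rest st out x↑ f≤st (avoids-push st f≤st av) ⟩
  (rest , lastL xs ++ f ∷ st , out ++ dropLast xs)
    ≡⟨ cong (λ s → (rest , s , out ++ dropLast xs)) (reverse-ends xs) ⟨
  (rest , reverse (ends (f ∷ xs)) ++ st , out ++ dropLast xs)
    ∎
  where
  open ≡-Reasoning
  k : ℕ
  k = length xs + length (dropLast xs)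
  reverse-ends : ∀ xs → reverse (ends (f ∷ xs)) ++ st ≡ lastL xs ++ f ∷ st
  reverse-ends []       = refl
  reverse-ends (y ∷ ys) rewrite lastL-lastOr y ys = refl

avoids-after-run : ∀ f xs st → f ≤Top st → Avoids st → Avoids (reverse (ends (f ∷ xs)) ++ st)
avoids-after-run f []       st f≤st av = avoids-push st f≤st av
avoids-after-run f (y ∷ ys) st f≤st av rewrite lastL-lastOr y ys =
  avoids-push₂ (lastOr y ys) st f≤st (avoids-push st f≤st av)

NextFits-after-run : ∀ inp f xs st → NextFits inp [ lastOr f xs ] →
                     NextFits inp (reverse (ends (f ∷ xs)) ++ st)
NextFits-after-run []      f xs       st _    = tt
NextFits-after-run (_ ∷ _) f []       st x≤f  = x≤f
NextFits-after-run (_ ∷ _) f (y ∷ ys) st x≤l rewrite lastL-lastOr y ys = x≤l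

data AscendingRuns : List (List ℕ) → Set where
  []  : AscendingRuns []
  run : ∀ {f xs rs} → Linked _<_ (f ∷ xs) → NextFits (concat rs) [ lastOr f xs ] →
        AscendingRuns rs → AscendingRuns ((f ∷ xs) ∷ rs)

feed-runs : ∀ {rs} st out → AscendingRuns rs → Avoids st → NextFits (concat rs) st →
            iterate (sum (map runSteps rs)) (concat rs , st , out)
              ≡ ([] , reverse (concat (map ends rs)) ++ st , out ++ concat (map middle rs))
feed-runs st out [] _ _ = cong (λ o → ([] , st , o)) (sym (++-identityʳ out))
feed-runs {(f ∷ xs) ∷ rs} st out (run x↑ fits rs↑) av f≤st = begin
  iterate (runSteps r + n) (r ++ concat rs , st , out)
    ≡⟨ iterate-+ (runSteps r) n (r ++ concat rs , st , out) ⟩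
  iterate n (iterate (runSteps r) (r ++ concat rs , st , out))
    ≡⟨ cong (iterate n) (feed-run (concat rs) st out x↑ f≤st av) ⟩
  iterate n (concat rs , reverse (ends r) ++ st , out ++ middle r)
    ≡⟨ feed-runs (reverse (ends r) ++ st) (out ++ middle r) rs↑
         (avoids-after-run f xs st f≤st av) (NextFits-after-run (concat rs) f xs st fits) ⟩
  ([] , reverse es ++ reverse (ends r) ++ st , (out ++ middle r) ++ concat (map middle rs))
    ≡⟨ cong₂ (λ s o → ([] , s , o)) stack (++-assoc out (middle r) _) ⟩
  ([] , reverse (ends r ++ es) ++ st , out ++ middle r ++ concat (map middle rs))
    ∎
  where
  open ≡-Reasoning
  r : List ℕ
  r = f ∷ xs
  n : ℕ
  n = sum (map runSteps rs)
  es : List ℕ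
  es = concat (map ends rs)
  stack : reverse es ++ reverse (ends r) ++ st ≡ reverse (ends r ++ es) ++ st
  stack = begin
    reverse es ++ reverse (ends r) ++ st    ≡⟨ ++-assoc (reverse es) (reverse (ends r)) st ⟨
    (reverse es ++ reverse (ends r)) ++ st  ≡⟨ cong (_++ st) (reverse-++ (ends r) es) ⟨
    reverse (ends r ++ es) ++ st            ∎

runSteps-+-ends : ∀ r → runSteps r + length (ends r) ≡ 2 * length r
runSteps-+-ends r = begin
  (length r + length (middle r)) + length (ends r)  ≡⟨ +-assoc (length r) _ _ ⟩
  length r + (length (middle r) + length (ends r))  ≡⟨ cong (length r +_) (length-middle-ends r) ⟩
  length r + length r                               ≡⟨ cong (length r +_) (+-identityʳ (length r)) ⟨
  2 * length r                                      ∎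
  where open ≡-Reasoning

steps-total : ∀ rs → sum (map runSteps rs) + length (concat (map ends rs)) ≡ 2 * length (concat rs)
steps-total []       = refl
steps-total (r ∷ rs) = begin
  (runSteps r + n) + length (ends r ++ es)             ≡⟨ cong (runSteps r + n +_) (length-++ (ends r)) ⟩
  (runSteps r + n) + (length (ends r) + length es)     ≡⟨ interchange (runSteps r) n (length (ends r)) _ ⟩
  (runSteps r + length (ends r)) + (n + length es)     ≡⟨ cong₂ _+_ (runSteps-+-ends r) (steps-total rs) ⟩
  2 * length r + 2 * length (concat rs)                ≡⟨ *-distribˡ-+ 2 (length r) _ ⟨
  2 * (length r + length (concat rs))                  ≡⟨ cong (2 *_) (length-++ r) ⟨
  2 * length (r ++ concat rs)                          ∎
  where
  open ≡-Reasoning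
  n : ℕ
  n = sum (map runSteps rs)
  es : List ℕ
  es = concat (map ends rs)

concat-runs : ∀ π → concat (runs π) ≡ π
concat-runs []       = refl
concat-runs (x ∷ xs) with runs xs | concat-runs xs
... | []           | e = cong (x ∷_) e
... | [] ∷ rs      | e = cong (x ∷_) e
... | (y ∷ r) ∷ rs | e with x <ᵇ y
...   | true  = cong (x ∷_) e
...   | false = cong (x ∷_) e

runs-ascending : ∀ π → AscendingRuns (runs π)
runs-ascending []       = []
runs-ascending (x ∷ xs) with runs xs | runs-ascending xs
... | []           | [] = run [-] tt []
... | (y ∷ r) ∷ rs | run y↑ fits rs↑ with x <ᵇ y | <ᵇ-reflects-< x y
...   | true  | ofʸ x<y = run (x<y ∷ y↑) fits rs↑
...   | false | ofⁿ x≮y = run [-] (≮⇒≥ x≮y) (run y↑ fits rs↑)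

SC321-runs : ∀ π → SC321 π ≡ concat (map middle (runs π)) ++ reverse (concat (map ends (runs π)))
SC321-runs π = begin
  output (iterate (2 * length π) (π , [] , []))
    ≡⟨ cong (λ σ → output (iterate (2 * length σ) (σ , [] , []))) (concat-runs π) ⟨
  output (iterate (2 * length (concat rs)) (concat rs , [] , []))
    ≡⟨ cong (λ k → output (iterate k (concat rs , [] , []))) (steps-total rs) ⟨
  output (iterate (n + length es) (concat rs , [] , []))
    ≡⟨ cong output (iterate-+ n (length es) (concat rs , [] , [])) ⟩
  output (iterate (length es) (iterate n (concat rs , [] , [])))
    ≡⟨ cong (output ∘ iterate (length es)) (feed-runs [] [] (runs-ascending π) refl (NextFits-[] (concat rs))) ⟩
  output (iterate (length es) ([] , reverse es ++ [] , ms))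
    ≡⟨ cong₂ (λ k s → output (iterate k ([] , s , ms))) (length-reverse es) (sym (++-identityʳ (reverse es))) ⟨
  output (iterate (length (reverse es)) ([] , reverse es , ms))
    ≡⟨ cong output (drain (reverse es) ms) ⟩
  ms ++ reverse es
    ∎
  where
  open ≡-Reasoning
  rs : List (List ℕ)
  rs = runs π
  n : ℕ
  n = sum (map runSteps rs)
  es : List ℕ
  es = concat (map ends rs)
  ms : List ℕ
  ms = concat (map middle rs)

lemma3p3 : (n : ℕ) (π : List ℕ) → IsPerm n π →
    (SC321 π ≡ concat (map middle (runs π)) ++ reverse (concat (map ends (runs π))))
    × (SC321 π ≡ concat (map middle (runs π)) ++ concat (map reverse (reverse (map ends (runs π)))))
lemma3p3 n π _ =
  SC321-runs π ,
  trans (SC321-runs π) (cong (concat (map middle (runs π)) ++_) (reverse-concat (map ends (runs π))))
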